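{- Let $\Gamma$ be a simple digraph and let $(a,b)\in E(\Gamma)$ be an arc with $(b,a)\notin E(\Gamma)$. Let $\Gamma_0$ be the digraph obtained from $\Gamma$ by replacing the arc $(a,b)$ with $(b,a)$. Then $\operatorname{th}(\Gamma_0)\le \operatorname{th}(\Gamma)+1$.
   Context: A simple digraph $\Gamma$ has a finite vertex set and no loops or parallel arcs (opposite arcs $(u,v),(v,u)$ allowed). $v$ is an out-neighbor of $u$ if $(u,v)\in E(\Gamma)$. Zero forcing: vertices are blue or white; a blue vertex $u$ with exactly one white out-neighbor $w$ may force $w$ ($u\to w$), turning it blue. A set $\mathcal F$ of forces is a set of forces of $B\subseteq V(\Gamma)$ if, starting with exactly $B$ blue, the forces in $\mathcal F$ can be validly performed in some order after which no further force is possible. Put $\mathcal F^{[0]}=B$ and $\mathcal F^{[t+1]}=\mathcal F^{[t]}\cup\{w\notin\mathcal F^{[t]}:(u\to w)\in\mathcal F,\ u\in\mathcal F^{[t]},\ w$ the only out-neighbor of $u$ outside $\mathcal F^{[t]}\}$; $\operatorname{pt}(\Gamma;\mathcal F)$ is the least $t$ with $\mathcal F^{[t]}=V(\Gamma)$ ($\infty$ if none). $\operatorname{pt}(\Gamma;B)=\min_{\mathcal F}\operatorname{pt}(\Gamma;\mathcal F)$ over sets of forces of $B$; $B$ is a zero forcing set if this is finite. The throttling number is $\operatorname{th}(\Gamma)=\min_{B\subseteq V(\Gamma)}(|B|+\operatorname{pt}(\Gamma;B))$. -}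

module Defs where

open import Data.Nat using (ℕ; zero; suc; _+_; _≤_)
open import Data.Fin using (Fin; _≟_)
open import Data.Fin.Subset using (Subset; _∈_; _∉_; _∪_; ⁅_⁆; ∣_∣)
open import Data.Bool using (Bool; true; false; if_then_else_; _∧_)
open import Data.Product using (_×_; _,_; ∃; ∃-syntax)
open import Data.Sum using (_⊎_)
open import Data.List using (List; []; _∷_)
open import Data.List.Membership.Propositional using () renaming (_∈_ to _∈ᴸ_)
open import Relation.Binary.PropositionalEquality using (_≡_; refl)
open import Relation.Nullary using (¬_; yes; no)
open import Relation.Nullary.Decidable using (⌊_⌋)

-- A simple digraph on vertex set Fin n: an arc relation (Bool-valued, so no
-- parallel arcs) without loops. Opposite arcs are allowed.
record Digraph (n : ℕ) : Set where
  field
    arc      : Fin n → Fin n → Bool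
    loopless : ∀ v → arc v v ≡ false
open Digraph public

reverseArcFn : ∀ {n} → (Fin n → Fin n → Bool) → Fin n → Fin n → Fin n → Fin n → Bool
reverseArcFn E a b x y =
  if ⌊ x ≟ a ⌋ ∧ ⌊ y ≟ b ⌋ then false
  else (if ⌊ x ≟ b ⌋ ∧ ⌊ y ≟ a ⌋ then true else E x y)

reverseArc-loopless : ∀ {n} (Γ : Digraph n) (a b : Fin n) (v : Fin n) →
  reverseArcFn (arc Γ) a b v v ≡ false
reverseArc-loopless Γ a b v with v ≟ a | v ≟ b
... | yes refl | yes refl = refl
... | yes refl | no _ = loopless Γ v
... | no _ | yes refl = loopless Γ v
reverseArc-loopless Γ a b v | no _ | no _ = loopless Γ v

reverseArc : ∀ {n} → Digraph n → Fin n → Fin n → Digraph n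
reverseArc Γ a b = record
  { arc = reverseArcFn (arc Γ) a b
  ; loopless = reverseArc-loopless Γ a b }

Force : ℕ → Set
Force n = Fin n × Fin n   -- (u , w) stands for the force u → w

CanForce : ∀ {n} → Digraph n → Subset n → Fin n → Fin n → Set
CanForce Γ S u w =
  u ∈ S × w ∉ S × arc Γ u w ≡ true ×
  (∀ x → arc Γ u x ≡ true → x ∉ S → x ≡ w)

data Run {n} (Γ : Digraph n) : Subset n → List (Force n) → Subset n → Set where
  done : ∀ {S} → Run Γ S [] S
  step : ∀ {S u w fs T} → CanForce Γ S u w →
         Run Γ (S ∪ ⁅ w ⁆) fs T → Run Γ S ((u , w) ∷ fs) T

Stalled : ∀ {n} → Digraph n → Subset n → Set
Stalled Γ T = ∀ u w → ¬ CanForce Γ T u w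

-- The set of forces {f | f ∈ fs} is a set of forces of B (fs lists it in a
-- valid chronological order).
IsSetOfForces : ∀ {n} → Digraph n → Subset n → List (Force n) → Set
IsSetOfForces Γ B fs = ∃[ T ] (Run Γ B fs T × Stalled Γ T)

-- Stage Γ B F t v  means  v ∈ F^[t].
Stage : ∀ {n} → Digraph n → Subset n → List (Force n) → ℕ → Fin n → Set
Stage Γ B F zero v = v ∈ B
Stage Γ B F (suc t) w =
  Stage Γ B F t w ⊎
  (¬ Stage Γ B F t w ×
   ∃[ u ] ((u , w) ∈ᴸ F × Stage Γ B F t u × arc Γ u w ≡ true ×
           (∀ x → arc Γ u x ≡ true → ¬ Stage Γ B F t x → x ≡ w)))

-- pt(Γ;F) ≤ t  iff  F^[t] = V(Γ)   (the stages are increasing).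
PtAtMost : ∀ {n} → Digraph n → Subset n → List (Force n) → ℕ → Set
PtAtMost Γ B F t = ∀ v → Stage Γ B F t v

ThrottleAtMost : ∀ {n} → Digraph n → ℕ → Set
ThrottleAtMost {n} Γ k =
  ∃[ B ] ∃[ F ] ∃[ t ] (IsSetOfForces Γ B F × PtAtMost Γ B F t × ∣ B ∣ + t ≤ k)

IsThrottlingNumber : ∀ {n} → Digraph n → ℕ → Set
IsThrottlingNumber Γ k = ThrottleAtMost Γ k × (∀ m → ThrottleAtMost Γ m → k ≤ m)

module Submission where

-- Take a blue set B and a set of forces F of B in Γ with |B| + pt(Γ;F) ≤ k.  We add one vertex x to B
-- and discard the force whose target is x; the remaining forces are then valid
-- in Γ₀ with the same propagation time, so th(Γ₀) ≤ k + 1.  Passing to Γ₀ can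
-- break a force in two ways only: a → b loses its arc, and a force by b gains
-- the new out-neighbour a.  Hence x is chosen as
--   x = a  when a → b ∉ F  (a is blue from the start), and
--   x = b  when a → b ∈ F  (that force is dropped; as only a forces b in Γ,
--          b is blue in Γ no earlier than a).

open import Defs
open import Data.Nat using (ℕ; _≤_; _+_; zero; suc; z≤n; s≤s)
open import Data.Nat.Properties using (≤-trans; ≤-reflexive; +-suc; +-comm; +-monoˡ-≤; +-monoʳ-≤; n≤1+n; module ≤-Reasoning)
open import Data.Fin using (Fin; _≟_)
open import Data.Fin.Properties using (any?; all?)
open import Data.Fin.Subset using (Subset; _∈_; _∉_; _∪_; ⁅_⁆; ∣_∣; inside; outside)
open import Data.Fin.Subset.Properties using (_∈?_; x∈⁅x⁆; x∈⁅y⁆⇒x≡y; x∈p∪q⁺; x∈p∪q⁻; ∪-assoc; ∪-comm; ∪-idem; ∣⁅x⁆∣≡1)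
open import Data.Bool using (true; false)
open import Data.Bool.Properties using () renaming (_≟_ to _≟ᵇ_)
open import Data.Vec using ([]; _∷_)
open import Data.Product using (_×_; _,_; ∃-syntax; proj₁; proj₂)
open import Data.Product.Properties using (≡-dec)
open import Data.Sum using (_⊎_; inj₁; inj₂)
open import Data.Empty using (⊥-elim)
open import Data.List using (List; _∷_; filter)
open import Data.List.Relation.Unary.Any using (here; there)
open import Data.List.Membership.Propositional using () renaming (_∈_ to _∈ᴸ_)
open import Data.List.Membership.Propositional.Properties using (∈-filter⁺)
import Data.List.Membership.DecPropositional as DecMembership
open import Relation.Binary.PropositionalEquality using (_≡_; _≢_; refl; sym; trans; cong; subst; module ≡-Reasoning)
open import Relation.Nullary using (¬_; yes; no; Dec)
open import Relation.Nullary.Decidable using (_×-dec_; _→-dec_; ¬?)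

∈-∪ˡ : ∀ {n} {v : Fin n} {p : Subset n} (q : Subset n) → v ∈ p → v ∈ p ∪ q
∈-∪ˡ q v∈p = x∈p∪q⁺ (inj₁ v∈p)

∈-∪ʳ : ∀ {n} {v : Fin n} (p : Subset n) {q : Subset n} → v ∈ q → v ∈ p ∪ q
∈-∪ʳ p v∈q = x∈p∪q⁺ (inj₂ v∈q)

∣p∪q∣≤∣p∣+∣q∣ : ∀ {n} (p q : Subset n) → ∣ p ∪ q ∣ ≤ ∣ p ∣ + ∣ q ∣
∣p∪q∣≤∣p∣+∣q∣ []            []            = z≤n
∣p∪q∣≤∣p∣+∣q∣ (outside ∷ p) (outside ∷ q) = ∣p∪q∣≤∣p∣+∣q∣ p q
∣p∪q∣≤∣p∣+∣q∣ (outside ∷ p) (inside ∷ q)  =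
  ≤-trans (s≤s (∣p∪q∣≤∣p∣+∣q∣ p q)) (≤-reflexive (sym (+-suc ∣ p ∣ ∣ q ∣)))
∣p∪q∣≤∣p∣+∣q∣ (inside ∷ p)  (outside ∷ q) = s≤s (∣p∪q∣≤∣p∣+∣q∣ p q)
∣p∪q∣≤∣p∣+∣q∣ (inside ∷ p)  (inside ∷ q)  =
  s≤s (≤-trans (∣p∪q∣≤∣p∣+∣q∣ p q) (+-monoʳ-≤ ∣ p ∣ (n≤1+n ∣ q ∣)))

∪-swap : ∀ {n} (p q r : Subset n) → (p ∪ q) ∪ r ≡ (p ∪ r) ∪ q
∪-swap p q r = begin
  (p ∪ q) ∪ r  ≡⟨ ∪-assoc p q r ⟩
  p ∪ (q ∪ r)  ≡⟨ cong (p ∪_) (∪-comm q r) ⟩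
  p ∪ (r ∪ q)  ≡⟨ sym (∪-assoc p r q) ⟩
  (p ∪ r) ∪ q  ∎
  where open ≡-Reasoning

∪-absorb : ∀ {n} (p q : Subset n) → (p ∪ q) ∪ q ≡ p ∪ q
∪-absorb p q = trans (∪-assoc p q q) (cong (p ∪_) (∪-idem q))

∣p∪⁅x⁆∣≤1+∣p∣ : ∀ {n} (p : Subset n) (x : Fin n) → ∣ p ∪ ⁅ x ⁆ ∣ ≤ suc ∣ p ∣
∣p∪⁅x⁆∣≤1+∣p∣ p x = begin
  ∣ p ∪ ⁅ x ⁆ ∣        ≤⟨ ∣p∪q∣≤∣p∣+∣q∣ p ⁅ x ⁆ ⟩
  ∣ p ∣ + ∣ ⁅ x ⁆ ∣    ≡⟨ cong (∣ p ∣ +_) (∣⁅x⁆∣≡1 x) ⟩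
  ∣ p ∣ + 1            ≡⟨ +-comm ∣ p ∣ 1 ⟩
  suc ∣ p ∣            ∎
  where open ≤-Reasoning

_∈ᶠ?_ : ∀ {n} (f : Force n) (fs : List (Force n)) → Dec (f ∈ᴸ fs)
_∈ᶠ?_ = DecMembership._∈?_ (≡-dec _≟_ _≟_)

module Runs {n} (G : Digraph n) where

  run-mono : ∀ {S fs T v} → Run G S fs T → v ∈ S → v ∈ T
  run-mono done         v∈S = v∈S
  run-mono (step _ run) v∈S = run-mono run (∈-∪ˡ _ v∈S)

  run-target : ∀ {S fs T u w} → Run G S fs T → (u , w) ∈ᴸ fs → w ∈ T
  run-target (step {w = w} _ run) (here refl) = run-mono run (∈-∪ʳ _ (x∈⁅x⁆ w))
  run-target (step _ run)         (there m)   = run-target run m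

  run-not-target : ∀ {S fs T u w} → Run G S fs T → w ∈ S → ¬ (u , w) ∈ᴸ fs
  run-not-target (step (_ , w∉S , _) _) w∈S (here refl) = w∉S w∈S
  run-not-target (step _ run)           w∈S (there m)   = run-not-target run (∈-∪ˡ _ w∈S) m

  run-unique-source : ∀ {S fs T u u′ w} → Run G S fs T →
    (u , w) ∈ᴸ fs → (u′ , w) ∈ᴸ fs → u ≡ u′
  run-unique-source (step _ _) (here refl) (here refl) = refl
  run-unique-source (step {w = w} _ run) (here refl) (there m) =
    ⊥-elim (run-not-target run (∈-∪ʳ _ (x∈⁅x⁆ w)) m)
  run-unique-source (step {w = w} _ run) (there m) (here refl) =
    ⊥-elim (run-not-target run (∈-∪ʳ _ (x∈⁅x⁆ w)) m)
  run-unique-source (step _ run) (there m) (there m′) = run-unique-source run m m′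

  full-stalled : ∀ {T} → (∀ v → v ∈ T) → Stalled G T
  full-stalled all-blue _ w (_ , w∉T , _) = w∉T (all-blue w)

module Stages {n} (G : Digraph n) (B : Subset n) (F : List (Force n)) where

  stage? : ∀ t v → Dec (Stage G B F t v)
  stage? zero v = v ∈? B
  stage? (suc t) w with stage? t w
  ... | yes s = yes (inj₁ s)
  ... | no ¬s with any? (λ u → ((u , w) ∈ᶠ? F) ×-dec stage? t u ×-dec (arc G u w ≟ᵇ true)
                 ×-dec all? (λ y → (arc G u y ≟ᵇ true) →-dec (¬? (stage? t y) →-dec (y ≟ w))))
  ...   | yes force = yes (inj₂ (¬s , force))
  ...   | no ¬force = no λ { (inj₁ s) → ¬s s ; (inj₂ (_ , force)) → ¬force force }

  initial-in-stage : ∀ t {v} → v ∈ B → Stage G B F t v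
  initial-in-stage zero    v∈B = v∈B
  initial-in-stage (suc t) v∈B = inj₁ (initial-in-stage t v∈B)

  stage-in-final : ∀ {T} → Run G B F T → ∀ t {v} → Stage G B F t v → v ∈ T
  stage-in-final run zero    s                      = Runs.run-mono G run s
  stage-in-final run (suc t) (inj₁ s)               = stage-in-final run t s
  stage-in-final run (suc t) (inj₂ (_ , _ , m , _)) = Runs.run-target G run m

  source-precedes : ∀ {a b} → b ∉ B → (∀ {u} → (u , b) ∈ᴸ F → u ≡ a) →
    ∀ t → Stage G B F t b → Stage G B F t a
  source-precedes b∉B only zero    s = ⊥-elim (b∉B s)
  source-precedes b∉B only (suc t) (inj₁ s) = inj₁ (source-precedes b∉B only t s)
  source-precedes b∉B only (suc t) (inj₂ (_ , u , m , u∈ , _)) =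
    inj₁ (subst (Stage G B F t) (only m) u∈)

dropInto : ∀ {n} → Fin n → List (Force n) → List (Force n)
dropInto x = filter (λ f → ¬? (proj₂ f ≟ x))

∈-dropInto : ∀ {n} {x u w : Fin n} {fs} → (u , w) ∈ᴸ fs → w ≢ x → (u , w) ∈ᴸ dropInto x fs
∈-dropInto {x = x} m w≢x = ∈-filter⁺ (λ f → ¬? (proj₂ f ≟ x)) m w≢x

module Reversal {n} (Γ : Digraph n) (a b : Fin n) where

  Γ₀ : Digraph n
  Γ₀ = reverseArc Γ a b

  reversed-arc⁻ : ∀ u y → arc Γ₀ u y ≡ true → (u ≡ b × y ≡ a) ⊎ arc Γ u y ≡ true
  reversed-arc⁻ u y h with u ≟ a | y ≟ b
  reversed-arc⁻ u y () | yes _ | yes _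
  ... | yes _ | no _ with u ≟ b | y ≟ a
  ...   | yes u≡b | yes y≡a = inj₁ (u≡b , y≡a)
  ...   | yes _   | no _    = inj₂ h
  ...   | no _    | _       = inj₂ h
  reversed-arc⁻ u y h | no _ | _ with u ≟ b | y ≟ a
  ...   | yes u≡b | yes y≡a = inj₁ (u≡b , y≡a)
  ...   | yes _   | no _    = inj₂ h
  ...   | no _    | _       = inj₂ h

  reversed-arc⁺ : ∀ u y → arc Γ u y ≡ true → ¬ (u ≡ a × y ≡ b) → arc Γ₀ u y ≡ true
  reversed-arc⁺ u y h ¬ab with u ≟ a | y ≟ b
  ... | yes u≡a | yes y≡b = ⊥-elim (¬ab (u≡a , y≡b))
  ... | yes _ | no _ with u ≟ b | y ≟ a
  ...   | yes _ | yes _ = refl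
  ...   | yes _ | no _  = h
  ...   | no _  | _     = h
  reversed-arc⁺ u y h ¬ab | no _ | _ with u ≟ b | y ≟ a
  ...   | yes _ | yes _ = refl
  ...   | yes _ | no _  = h
  ...   | no _  | _     = h

  unique-white-transfer : (Blue Blue₀ : Fin n → Set) → (∀ {y} → Blue y → Blue₀ y) →
    ∀ {u w} → (u ≡ b → Blue₀ a) →
    (∀ y → arc Γ u y ≡ true → ¬ Blue y → y ≡ w) →
    ∀ y → arc Γ₀ u y ≡ true → ¬ Blue₀ y → y ≡ w
  unique-white-transfer Blue Blue₀ blue⇒blue₀ {u} a-blue unique y u→y y-white
    with reversed-arc⁻ u y u→y
  ... | inj₁ (refl , refl) = ⊥-elim (y-white (a-blue refl))
  ... | inj₂ u→y-in-Γ       = unique y u→y-in-Γ (λ y-blue → y-white (blue⇒blue₀ y-blue))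

module Transfer {n} (Γ : Digraph n) (a b x : Fin n) where
  open Reversal Γ a b

  AvoidsArc : List (Force n) → Set
  AvoidsArc fs = ∀ {u w} → (u , w) ∈ᴸ fs → w ≢ x → ¬ (u ≡ a × w ≡ b)

  OnlyAForcesB : List (Force n) → Set
  OnlyAForcesB fs = ∀ {u} → (u , b) ∈ᴸ fs → u ≡ a

  GuardsB : List (Force n) → Set
  GuardsB fs = a ≡ x ⊎ OnlyAForcesB fs

  guards-tail : ∀ {f fs} → GuardsB (f ∷ fs) → GuardsB fs
  guards-tail (inj₁ a≡x)  = inj₁ a≡x
  guards-tail (inj₂ only) = inj₂ (λ m → only (there m))

  force-transfer : ∀ {S u w} → CanForce Γ S u w → w ≢ x → ¬ (u ≡ a × w ≡ b) →
    (b ∈ S → a ∈ S ∪ ⁅ x ⁆) → CanForce Γ₀ (S ∪ ⁅ x ⁆) u w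
  force-transfer {S} {u} {w} (u∈S , w∉S , u→w , unique) w≢x ¬ab b⇒a =
    ∈-∪ˡ _ u∈S , w∉S∪x , reversed-arc⁺ u w u→w ¬ab ,
    unique-white-transfer (_∈ S) (_∈ S ∪ ⁅ x ⁆) (∈-∪ˡ _)
      (λ u≡b → b⇒a (subst (_∈ S) u≡b u∈S)) unique
    where
    w∉S∪x : w ∉ S ∪ ⁅ x ⁆
    w∉S∪x w∈ with x∈p∪q⁻ S ⁅ x ⁆ w∈
    ... | inj₁ w∈S = w∉S w∈S
    ... | inj₂ w∈x = w≢x (x∈⁅y⁆⇒x≡y x w∈x)

  b⇒a-step : ∀ {S u w fs} → u ∈ S → GuardsB ((u , w) ∷ fs) →
    (b ∈ S → a ∈ S ∪ ⁅ x ⁆) → b ∈ S ∪ ⁅ w ⁆ → a ∈ (S ∪ ⁅ w ⁆) ∪ ⁅ x ⁆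
  b⇒a-step {S} {u} {w} u∈S guard b⇒a b∈ with x∈p∪q⁻ S ⁅ w ⁆ b∈ | guard
  ... | inj₁ b∈S | _ =
    subst (a ∈_) (sym (∪-swap S ⁅ w ⁆ ⁅ x ⁆)) (∈-∪ˡ _ (b⇒a b∈S))
  ... | inj₂ _ | inj₁ a≡x = ∈-∪ʳ _ (subst (_∈ ⁅ x ⁆) (sym a≡x) (x∈⁅x⁆ x))
  ... | inj₂ b∈w | inj₂ only =
    ∈-∪ˡ _ (∈-∪ˡ _ (subst (_∈ S) (only (here (cong (u ,_) (x∈⁅y⁆⇒x≡y w b∈w)))) u∈S))

  step-transfer : ∀ {S u w fs T₀} → CanForce Γ S u w → AvoidsArc ((u , w) ∷ fs) →
    (b ∈ S → a ∈ S ∪ ⁅ x ⁆) → Run Γ₀ ((S ∪ ⁅ w ⁆) ∪ ⁅ x ⁆) (dropInto x fs) T₀ →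
    Run Γ₀ (S ∪ ⁅ x ⁆) (dropInto x ((u , w) ∷ fs)) T₀
  step-transfer {S} {w = w} can avoids b⇒a rest with w ≟ x
  ... | yes refl = subst (λ X → Run Γ₀ X _ _) (∪-absorb S ⁅ x ⁆) rest
  ... | no w≢x   = step (force-transfer can w≢x (avoids (here refl) w≢x) b⇒a)
                        (subst (λ X → Run Γ₀ X _ _) (∪-swap S ⁅ w ⁆ ⁅ x ⁆) rest)

  run-transfer : ∀ {S fs T} → Run Γ S fs T → AvoidsArc fs → GuardsB fs →
    (b ∈ S → a ∈ S ∪ ⁅ x ⁆) → Run Γ₀ (S ∪ ⁅ x ⁆) (dropInto x fs) (T ∪ ⁅ x ⁆)
  run-transfer done _ _ _ = done
  run-transfer (step can run) avoids guard b⇒a =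
    step-transfer can avoids b⇒a
      (run-transfer run (λ m → avoids (there m)) (guards-tail guard)
         (b⇒a-step (proj₁ can) guard b⇒a))

  Compatible : Subset n → List (Force n) → Set
  Compatible B F = AvoidsArc F × (a ≡ x ⊎ (b ∉ B × OnlyAForcesB F))

  module StageTransfer (B : Subset n) (F : List (Force n)) (compatible : Compatible B F) where

    B₀ : Subset n
    B₀ = B ∪ ⁅ x ⁆

    F₀ : List (Force n)
    F₀ = dropInto x F

    x-in-stage : ∀ t {v} → v ≡ x → Stage Γ₀ B₀ F₀ t v
    x-in-stage t refl = Stages.initial-in-stage Γ₀ B₀ F₀ t (∈-∪ʳ B (x∈⁅x⁆ x))

    a-first : ∀ t → Stage Γ B F t b → Stage Γ B F t a ⊎ a ≡ x
    a-first t b∈ with proj₂ compatible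
    ... | inj₁ a≡x          = inj₂ a≡x
    ... | inj₂ (b∉B , only) = inj₁ (Stages.source-precedes Γ B F b∉B only t b∈)

    -- Each force u → v of stage t+1 in Γ either finds v already blue in Γ₀ or
    -- is performed there too, since v ≠ x and a is blue in Γ₀ whenever u = b.
    stage-transfer : ∀ t {v} → Stage Γ B F t v → Stage Γ₀ B₀ F₀ t v
    stage-transfer zero    v∈B      = ∈-∪ˡ _ v∈B
    stage-transfer (suc t) (inj₁ s) = inj₁ (stage-transfer t s)
    stage-transfer (suc t) {v} (inj₂ (_ , u , m , u∈ , u→v , unique))
      with Stages.stage? Γ₀ B₀ F₀ t v
    ... | yes s = inj₁ s
    ... | no ¬s = inj₂ (¬s , u , ∈-dropInto m v≢x , stage-transfer t u∈ ,
                        reversed-arc⁺ u v u→v (proj₁ compatible m v≢x) ,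
                        unique-white-transfer (Stage Γ B F t) (Stage Γ₀ B₀ F₀ t)
                          (stage-transfer t) a-blue unique)
      where
      v≢x : v ≢ x
      v≢x v≡x = ¬s (x-in-stage t v≡x)

      a-blue : u ≡ b → Stage Γ₀ B₀ F₀ t a
      a-blue u≡b with a-first t (subst (Stage Γ B F t) u≡b u∈)
      ... | inj₁ a∈  = stage-transfer t a∈
      ... | inj₂ a≡x = x-in-stage t a≡x

  throttle-transfer : ∀ {B F T p k} → Compatible B F → Run Γ B F T →
    PtAtMost Γ B F p → ∣ B ∣ + p ≤ k → ThrottleAtMost Γ₀ (k + 1)
  throttle-transfer {B} {F} {T} {p} {k} compatible run pt size =
    B₀ , F₀ , p , (T ∪ ⁅ x ⁆ , run₀ , Runs.full-stalled Γ₀ all-blue) ,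
    (λ v → stage-transfer p (pt v)) , size₀
    where
    open StageTransfer B F compatible

    guards : GuardsB F
    guards with proj₂ compatible
    ... | inj₁ a≡x        = inj₁ a≡x
    ... | inj₂ (_ , only) = inj₂ only

    b⇒a : b ∈ B → a ∈ B₀
    b⇒a b∈B with proj₂ compatible
    ... | inj₁ refl      = ∈-∪ʳ B (x∈⁅x⁆ x)
    ... | inj₂ (b∉B , _) = ⊥-elim (b∉B b∈B)

    run₀ : Run Γ₀ B₀ F₀ (T ∪ ⁅ x ⁆)
    run₀ = run-transfer run (proj₁ compatible) guards b⇒a

    all-blue : ∀ v → v ∈ T ∪ ⁅ x ⁆
    all-blue v = ∈-∪ˡ _ (Stages.stage-in-final Γ B F run p (pt v))

    size₀ : ∣ B₀ ∣ + p ≤ k + 1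
    size₀ = begin
      ∣ B ∪ ⁅ x ⁆ ∣ + p  ≤⟨ +-monoˡ-≤ p (∣p∪⁅x⁆∣≤1+∣p∣ B x) ⟩
      suc (∣ B ∣ + p)    ≤⟨ s≤s size ⟩
      suc k              ≡⟨ +-comm 1 k ⟩
      k + 1              ∎
      where open ≤-Reasoning

-- For every valid run of F from B some vertex x is compatible: x = a if the
-- force a → b is not used, and x = b (forced only by a) if it is.
compatible-vertex : ∀ {n} (Γ : Digraph n) (a b : Fin n) {B F T} → Run Γ B F T →
  ∃[ x ] Transfer.Compatible Γ a b x B F
compatible-vertex Γ a b {F = F} run with (a , b) ∈ᶠ? F
... | no ab∉F  = a , (λ { m _ (refl , refl) → ab∉F m }) , inj₁ refl
... | yes ab∈F = b , (λ _ w≢b (_ , w≡b) → w≢b w≡b) ,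
                 inj₂ ((λ b∈B → Runs.run-not-target Γ run b∈B ab∈F) ,
                       (λ m → Runs.run-unique-source Γ run m ab∈F))

reversal-throttle : ∀ {n} (Γ : Digraph n) (a b : Fin n) {k} →
  ThrottleAtMost Γ k → ThrottleAtMost (reverseArc Γ a b) (k + 1)
reversal-throttle Γ a b (B , F , p , (T , run , _) , pt , size)
  with compatible-vertex Γ a b run
... | x , compatible = Transfer.throttle-transfer Γ a b x compatible run pt size

proposition2p8 : ∀ {n} (Γ : Digraph n) (a b : Fin n) →
    arc Γ a b ≡ true → arc Γ b a ≡ false →
    ∀ (t t₀ : ℕ) → IsThrottlingNumber Γ t →
    IsThrottlingNumber (reverseArc Γ a b) t₀ → t₀ ≤ t + 1
proposition2p8 Γ a b _ _ t t₀ (th≤t , _) (_ , t₀-least) =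
  t₀-least (t + 1) (reversal-throttle Γ a b th≤t)
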